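{- Let $k\ge1$ and let $\tau$ be a bijection of $\Delta_k^\pm$ onto itself (one fixed choice of sign). If there exist $P_0\in\Delta^-$ and $Q_0\in\Delta_k^\pm(P_0)$ with $\tau(Q_0)\notin\Delta_k^\pm(\eta(P_0))$, then $\prod_{Q\in\Delta_k^\pm(P_0)}\widetilde e^{\mathrm{res}}_{pQ-\tau(Q)}=0$.
   Context: Fix $n\ge1$ and linearly independent $\mathbf V_1,\dots,\mathbf V_n\in\mathbb Z^n$; $\Delta=\{\sum_iz_i\mathbf V_i:0\le z_i\le1\}$, origin $\mathcal O$, $\Delta_1^+=\Delta\cap\mathbb Z^n$; $\mathbb M(\Delta)=\{\sum_iz_i\mathbf V_i:z_i\ge0\}\cap\mathbb Z^n$; $p$ a prime. For $k\ge0$: $\Delta_k^+=\{\sum_iz_i\mathbf V_i\in\mathbb Z^n:0\le z_i\le k\}$, $\Delta_k^-=\{\sum_iz_i\mathbf V_i\in\mathbb Z^n:0\le z_i<k\}$, $\Delta^-=\Delta_1^-$. For $P_0\in\Delta^-$, $\Delta_k^\pm(P_0)=\{Q\in\Delta_k^\pm:Q-P_0\in\bigoplus_i\mathbb Z\mathbf V_i\}$. $\eta:\Delta^-\to\Delta^-$ sends $Q$ to the unique element of $\Delta^-$ congruent to $pQ$ modulo $\bigoplus_i\mathbb Z\mathbf V_i$. $E(\pi)=\exp(\sum_{i\ge0}\pi^{p^i}/p^i)$ is the Artin–Hasse exponential, $E(\pi)=1+T$. With indeterminates $\widetilde a_P$ ($P\in\Delta_1^+\setminus\{\mathcal O\}$),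 $\widetilde e_Q(T)$ is the coefficient of $\underline x^Q$ in $\prod_{P\in\Delta_1^+\setminus\{\mathcal O\}}E(\widetilde a_P\pi\underline x^P)$ (zero if it does not occur). For nonempty $S\subseteq\{1,\dots,n\}$, $\mathbf V_S=\sum_{i\in S}\mathbf V_i$; $\widetilde e^{\mathrm{res}}_Q$ is obtained from $\widetilde e_Q$ by setting $\widetilde a_P=0$ for $P$ not of the form $\mathbf V_S$ and $\widetilde a_{\mathbf V_S}=\widetilde a_{\#S}$ for new indeterminates $\widetilde a_1,\dots,\widetilde a_n$. -}

module Defs where

open import Data.Bool using (Bool; true; false; if_then_else_; _∧_)
open import Data.Bool.ListAction using (any)
open import Data.Nat as ℕ using (ℕ; zero; suc; _!; _^_; _≡ᵇ_; _≤ᵇ_)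
open import Data.Nat.Properties using (_!≢0)
open import Data.Integer as ℤ using (ℤ; +_)
open import Data.Rational as ℚ using (ℚ; 0ℚ; 1ℚ)
import Data.Rational.Properties as ℚP
import Data.Integer.Properties as ℤP
open import Data.Fin using (Fin)
import Data.Fin as Fin
open import Data.Vec as Vec using (Vec; []; _∷_)
import Data.Vec.Properties as VecP
open import Data.List as List using (List; []; _∷_)
open import Data.Product using (Σ; _×_)
open import Function using (_∘_; id)
open import Relation.Nullary using (does)
open import Relation.Binary.PropositionalEquality using (_≡_)

Pt : ℕ → Set
Pt n = Vec ℤ n

zeroPt : ∀ {n} → Pt n
zeroPt = Vec.replicate _ (+ 0)

_+ᵥ_ : ∀ {n} → Pt n → Pt n → Pt n
_+ᵥ_ = Vec.zipWith ℤ._+_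

_-ᵥ_ : ∀ {n} → Pt n → Pt n → Pt n
_-ᵥ_ = Vec.zipWith ℤ._-_

_·ᵥ_ : ∀ {n} → ℤ → Pt n → Pt n
c ·ᵥ Q = Vec.map (c ℤ.*_) Q

sumPt : ∀ {m n} → (Fin m → Pt n) → Pt n
sumPt {zero}  f = zeroPt
sumPt {suc m} f = f Fin.zero +ᵥ sumPt (f ∘ Fin.suc)

zcomb : ∀ {n} → (Fin n → ℤ) → (Fin n → Pt n) → Pt n
zcomb c V = sumPt (λ i → c i ·ᵥ V i)

toℚ : ℤ → ℚ
toℚ c = c ℚ./ 1

toℚv : ∀ {n} → Pt n → Vec ℚ n
toℚv = Vec.map toℚ

sumℚv : ∀ {m n} → (Fin m → Vec ℚ n) → Vec ℚ n
sumℚv {zero}  f = Vec.replicate _ 0ℚ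
sumℚv {suc m} f = Vec.zipWith ℚ._+_ (f Fin.zero) (sumℚv (f ∘ Fin.suc))

qcomb : ∀ {n} → (Fin n → ℚ) → (Fin n → Pt n) → Vec ℚ n
qcomb z V = sumℚv (λ i → Vec.map (λ c → z i ℚ.* toℚ c) (V i))

LinIndep : ∀ {n} → (Fin n → Pt n) → Set
LinIndep {n} V = (z : Fin n → ℚ) → qcomb z V ≡ Vec.replicate n 0ℚ → ∀ i → z i ≡ 0ℚ

data Sign : Set where
  plus minus : Sign

InRange : Sign → ℕ → ℚ → Set
InRange plus  k z = (0ℚ ℚ.≤ z) × (z ℚ.≤ toℚ (+ k))
InRange minus k z = (0ℚ ℚ.≤ z) × (z ℚ.< toℚ (+ k))

InΔ : ∀ {n} → Sign → ℕ → (Fin n → Pt n) → Pt n → Set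
InΔ {n} s k V Q = Σ (Fin n → ℚ) λ z → (toℚv Q ≡ qcomb z V) × (∀ i → InRange s k (z i))

InLattice : ∀ {n} → (Fin n → Pt n) → Pt n → Set
InLattice {n} V R = Σ (Fin n → ℤ) λ c → R ≡ zcomb c V

InΔP : ∀ {n} → Sign → ℕ → (Fin n → Pt n) → Pt n → Pt n → Set
InΔP s k V P₀ Q = InΔ s k V Q × InLattice V (Q -ᵥ P₀)

-- P₁ = η(P₀) : P₁ ∈ Δ⁻ and P₁ ≡ p P₀ modulo ⊕ ℤ V_i  (η(P₀) is the unique such point)
IsEta : ∀ {n} → ℕ → (Fin n → Pt n) → Pt n → Pt n → Set
IsEta p V P₀ P₁ = InΔ minus 1 V P₁ × InLattice V (((+ p) ·ᵥ P₀) -ᵥ P₁)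

IsBijOn : ∀ {n} → (Pt n → Set) → (Pt n → Pt n) → Set
IsBijOn {n} A τ =
  ((Q : Pt n) → A Q → A (τ Q)) ×
  ((Q Q′ : Pt n) → A Q → A Q′ → τ Q ≡ τ Q′ → Q ≡ Q′) ×
  ((Q′ : Pt n) → A Q′ → Σ (Pt n) λ Q → A Q × (τ Q ≡ Q′))

sumℚ : List ℚ → ℚ
sumℚ = List.foldr ℚ._+_ 0ℚ

-- Artin–Hasse exponential  E(π) = exp(L(π)),  L(π) = Σ_{i≥0} π^{p^i}/p^i,
-- as a formal power series in one variable (coefficient functions ℕ → ℚ).

PS1 : Set
PS1 = ℕ → ℚ

one1 : PS1
one1 zero    = 1ℚ
one1 (suc _) = 0ℚ

mul1 : PS1 → PS1 → PS1
mul1 f g m = sumℚ (List.map (λ i → f i ℚ.* g (m ℕ.∸ i)) (List.upTo (suc m)))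

pow1 : PS1 → ℕ → PS1
pow1 f zero    = one1
pow1 f (suc k) = mul1 f (pow1 f k)

-- j is a power p^i of p (necessarily i ≤ j)
isPowOf : ℕ → ℕ → Bool
isPowOf p j = any (λ i → (p ^ i) ≡ᵇ j) (List.upTo (suc j))

AHlog : ℕ → PS1
AHlog p zero    = 0ℚ
AHlog p (suc j) = if isPowOf p (suc j) then (+ 1 ℚ./ suc j) else 0ℚ

-- coefficient of π^m in E(π) = Σ_{k≥0} L^k/k!  (L has no constant term,
-- so only k ≤ m contribute to the coefficient of π^m)
AH : ℕ → PS1
AH p m = sumℚ (List.map (λ k → pow1 (AHlog p) k m ℚ.* ((+ 1 ℚ./ (k !)) {{k !≢0}}))
                        (List.upTo (suc m)))

-- Formal power series in π, ã₁,…,ãₙ over ℚ.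
-- A series is its coefficient function: f m α = coefficient of π^m ã^α,
-- where α : Vec ℕ n and position i (0-based) is the exponent of ã_{i+1}.

Series : ℕ → Set
Series n = ℕ → Vec ℕ n → ℚ

below : ∀ {n} → Vec ℕ n → List (Vec ℕ n)
below []      = [] ∷ []
below (a ∷ α) = List.concatMap (λ b → List.map (b ∷_) (below α)) (List.upTo (suc a))

oneS : ∀ {n} → Series n
oneS m α = if (m ≡ᵇ 0) ∧ does (VecP.≡-dec ℕ._≟_ α (Vec.replicate _ 0)) then 1ℚ else 0ℚ

_*S_ : ∀ {n} → Series n → Series n → Series n
(f *S g) m α =
  sumℚ (List.concatMap
          (λ i → List.map (λ β → f i β ℚ.* g (m ℕ.∸ i) (Vec.zipWith ℕ._∸_ α β)) (below α))
          (List.upTo (suc m)))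

prodS : ∀ {n} → List (Series n) → Series n
prodS []       = oneS
prodS (f ∷ fs) = f *S prodS fs

IsZeroS : ∀ {n} → Series n → Set
IsZeroS f = ∀ m α → f m α ≡ 0ℚ

subsets : (n : ℕ) → List (Vec Bool n)
subsets zero    = [] ∷ []
subsets (suc n) = List.concatMap (λ S → (true ∷ S) ∷ (false ∷ S) ∷ []) (subsets n)

nonemptySubsets : (n : ℕ) → List (Vec Bool n)
nonemptySubsets n = List.filterᵇ (λ S → Vec.foldr _ Data.Bool._∨_ false S) (subsets n)
  where import Data.Bool

card : ∀ {n} → Vec Bool n → ℕ
card = Vec.countᵇ id

VS : ∀ {n} → (Fin n → Pt n) → Vec Bool n → Pt n
VS V S = sumPt (λ i → if Vec.lookup S i then V i else zeroPt)

-- exponent of ã_{c+1} in α (0 if out of range)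
expAt : ∀ {n} → Vec ℕ n → ℕ → ℕ
expAt []      _       = 0
expAt (a ∷ α) zero    = a
expAt (a ∷ α) (suc c) = expAt α c

subAt : ∀ {n} → Vec ℕ n → ℕ → ℕ → Vec ℕ n
subAt []      _       j = []
subAt (a ∷ α) zero    j = (a ℕ.∸ j) ∷ α
subAt (a ∷ α) (suc c) j = a ∷ subAt α c j

-- ẽ^res_R : coefficient of x^R in  ∏_{∅≠S⊆{1..n}} E(ã_{#S} π x^{V_S}).
-- coeffX L R m α = coefficient of x^R π^m ã^α in ∏_{S∈L} E(ã_{#S} π x^{V_S}),
-- computed factor by factor:  E(ã_c π x^W) = Σ_j u_j ã_c^j π^j x^{jW}.

coeffX : ∀ {n} → ℕ → (Fin n → Pt n) → List (Vec Bool n) → Pt n → Series n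
coeffX p V [] R m α =
  if does (VecP.≡-dec ℤP._≟_ R zeroPt) then oneS m α else 0ℚ
coeffX p V (S ∷ L) R m α =
  sumℚ (List.map
    (λ j → if j ≤ᵇ expAt α (card S ℕ.∸ 1)
           then AH p j ℚ.* coeffX p V L (R -ᵥ ((+ j) ·ᵥ VS V S)) (m ℕ.∸ j) (subAt α (card S ℕ.∸ 1) j)
           else 0ℚ)
    (List.upTo (suc m)))

eres : ∀ {n} → ℕ → (Fin n → Pt n) → Pt n → Series n
eres {n} p V R = coeffX p V (nonemptySubsets n) R

{-# OPTIONS --safe #-}
-- Every monomial of ∏_S E(ã_{#S} π x^{V_S}) has x-exponent Σ_S j_S V_S, a point of
-- the lattice Λ = ⊕ ℤ V_i, so ẽ^res_R vanishes identically unless R ∈ Λ.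
-- Modulo Λ we have p Q₀ − τ(Q₀) ≡ p P₀ − τ(Q₀) ≡ η(P₀) − τ(Q₀), and this is not in Λ
-- because τ(Q₀) ∈ Δ_k^± but τ(Q₀) ∉ Δ_k^±(η(P₀)).  So the factor of index Q₀ is zero,
-- and with it the whole product.
module Submission where

open import Defs
open import Data.Nat as ℕ using (ℕ; suc; _≤_)
open import Data.Nat.Primality using (Prime)
open import Data.Integer as ℤ using (ℤ; +_)
open import Data.Integer.Tactic.RingSolver using (solve-∀)
import Data.Integer.Properties as ℤP
open import Data.Rational as ℚ using (0ℚ)
import Data.Rational.Properties as ℚP
open import Data.Fin as Fin using (Fin)
open import Data.Vec as Vec using ([]; _∷_)
import Data.Vec.Properties as VecP
open import Data.List as List using (List; []; _∷_; map)
open import Data.List.Properties using (foldr-preservesᵇ)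
open import Data.List.Relation.Unary.All using (All; universal)
open import Data.List.Relation.Unary.All.Properties using (concat⁺) renaming (map⁺ to All-map⁺)
open import Data.List.Relation.Unary.Any using (Any; here; there)
open import Data.List.Relation.Unary.Any.Properties using () renaming (map⁺ to Any-map⁺)
open import Data.List.Membership.Propositional using (_∈_; lose)
open import Data.List.Relation.Unary.Unique.Propositional using (Unique)
open import Data.Bool using (true; false; if_then_else_)
open import Data.Product using (_×_; _,_; proj₂)
open import Data.Empty using (⊥-elim)
open import Function using (_∘_)
open import Relation.Nullary using (¬_; yes; no)
open import Relation.Binary.PropositionalEquality
open import Algebra.Properties.CommutativeSemigroup ℤP.+-commutativeSemigroup using (interchange)

+ᵥ-identityˡ : ∀ {n} (v : Pt n) → zeroPt +ᵥ v ≡ v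
+ᵥ-identityˡ []      = refl
+ᵥ-identityˡ (x ∷ v) = cong₂ _∷_ (ℤP.+-identityˡ x) (+ᵥ-identityˡ v)

+ᵥ-interchange : ∀ {n} (a b c d : Pt n) → (a +ᵥ b) +ᵥ (c +ᵥ d) ≡ (a +ᵥ c) +ᵥ (b +ᵥ d)
+ᵥ-interchange []       []       []       []       = refl
+ᵥ-interchange (a ∷ as) (b ∷ bs) (c ∷ cs) (d ∷ ds) =
  cong₂ _∷_ (interchange a b c d) (+ᵥ-interchange as bs cs ds)

·ᵥ-zeroˡ : ∀ {n} (v : Pt n) → (+ 0) ·ᵥ v ≡ zeroPt
·ᵥ-zeroˡ []      = refl
·ᵥ-zeroˡ (x ∷ v) = cong (_ ∷_) (·ᵥ-zeroˡ v)

·ᵥ-zeroʳ : ∀ {n} a → a ·ᵥ zeroPt {n} ≡ zeroPt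
·ᵥ-zeroʳ {ℕ.zero} a = refl
·ᵥ-zeroʳ {suc n}  a = cong₂ _∷_ (ℤP.*-zeroʳ a) (·ᵥ-zeroʳ a)

·ᵥ-identityˡ : ∀ {n} (v : Pt n) → (+ 1) ·ᵥ v ≡ v
·ᵥ-identityˡ []      = refl
·ᵥ-identityˡ (x ∷ v) = cong₂ _∷_ (ℤP.*-identityˡ x) (·ᵥ-identityˡ v)

·ᵥ-assoc : ∀ {n} a b (v : Pt n) → (a ℤ.* b) ·ᵥ v ≡ a ·ᵥ (b ·ᵥ v)
·ᵥ-assoc a b []      = refl
·ᵥ-assoc a b (x ∷ v) = cong₂ _∷_ (ℤP.*-assoc a b x) (·ᵥ-assoc a b v)

·ᵥ-distribʳ-+ : ∀ {n} a b (v : Pt n) → (a ℤ.+ b) ·ᵥ v ≡ (a ·ᵥ v) +ᵥ (b ·ᵥ v)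
·ᵥ-distribʳ-+ a b []      = refl
·ᵥ-distribʳ-+ a b (x ∷ v) = cong₂ _∷_ (ℤP.*-distribʳ-+ x a b) (·ᵥ-distribʳ-+ a b v)

·ᵥ-distribˡ-+ᵥ : ∀ {n} a (u v : Pt n) → a ·ᵥ (u +ᵥ v) ≡ (a ·ᵥ u) +ᵥ (a ·ᵥ v)
·ᵥ-distribˡ-+ᵥ a []      []      = refl
·ᵥ-distribˡ-+ᵥ a (x ∷ u) (y ∷ v) = cong₂ _∷_ (ℤP.*-distribˡ-+ a x y) (·ᵥ-distribˡ-+ᵥ a u v)

-ᵥ-as-+ᵥ : ∀ {n} (u v : Pt n) → u -ᵥ v ≡ u +ᵥ (ℤ.-1ℤ ·ᵥ v)
-ᵥ-as-+ᵥ []      []      = refl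
-ᵥ-as-+ᵥ (x ∷ u) (y ∷ v) = cong₂ _∷_ (cong (ℤ._+_ x) (sym (ℤP.-1*i≡-i y))) (-ᵥ-as-+ᵥ u v)

-ᵥ-+ᵥ-cancel : ∀ {n} (r w : Pt n) → r ≡ (r -ᵥ w) +ᵥ w
-ᵥ-+ᵥ-cancel []       []       = refl
-ᵥ-+ᵥ-cancel (r ∷ rs) (w ∷ ws) = cong₂ _∷_ (identity r w) (-ᵥ-+ᵥ-cancel rs ws)
  where
  identity : ∀ (r w : ℤ) → r ≡ (r ℤ.- w) ℤ.+ w
  identity = solve-∀

difference-through-scaling : ∀ {n} p (Q T P₁ P₀ : Pt n) →
  T -ᵥ P₁ ≡ ((p ·ᵥ (Q -ᵥ P₀)) +ᵥ ((p ·ᵥ P₀) -ᵥ P₁)) -ᵥ ((p ·ᵥ Q) -ᵥ T)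
difference-through-scaling p [] [] [] [] = refl
difference-through-scaling p (q ∷ qs) (t ∷ ts) (e ∷ es) (o ∷ os) =
  cong₂ _∷_ (identity p q t e o) (difference-through-scaling p qs ts es os)
  where
  identity : ∀ (p q t e o : ℤ) → t ℤ.- e ≡ (p ℤ.* (q ℤ.- o) ℤ.+ (p ℤ.* o ℤ.- e)) ℤ.- (p ℤ.* q ℤ.- t)
  identity = solve-∀

sumPt-cong : ∀ {m n} {f g : Fin m → Pt n} → (∀ i → f i ≡ g i) → sumPt f ≡ sumPt g
sumPt-cong {ℕ.zero} f≡g = refl
sumPt-cong {suc m}  f≡g = cong₂ _+ᵥ_ (f≡g Fin.zero) (sumPt-cong (f≡g ∘ Fin.suc))

sumPt-+ᵥ : ∀ {m n} (f g : Fin m → Pt n) → sumPt (λ i → f i +ᵥ g i) ≡ sumPt f +ᵥ sumPt g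
sumPt-+ᵥ {ℕ.zero} f g = sym (+ᵥ-identityˡ zeroPt)
sumPt-+ᵥ {suc m}  f g = trans (cong ((f Fin.zero +ᵥ g Fin.zero) +ᵥ_) (sumPt-+ᵥ (f ∘ Fin.suc) (g ∘ Fin.suc)))
                              (+ᵥ-interchange _ _ _ _)

sumPt-·ᵥ : ∀ {m n} a (f : Fin m → Pt n) → sumPt (λ i → a ·ᵥ f i) ≡ a ·ᵥ sumPt f
sumPt-·ᵥ {ℕ.zero} a f = sym (·ᵥ-zeroʳ a)
sumPt-·ᵥ {suc m}  a f = trans (cong ((a ·ᵥ f Fin.zero) +ᵥ_) (sumPt-·ᵥ a (f ∘ Fin.suc)))
                              (sym (·ᵥ-distribˡ-+ᵥ a _ _))

module _ {n} (V : Fin n → Pt n) where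

  InLattice-+ᵥ : ∀ {u v} → InLattice V u → InLattice V v → InLattice V (u +ᵥ v)
  InLattice-+ᵥ (c , refl) (d , refl) = (λ i → c i ℤ.+ d i) ,
    sym (trans (sumPt-cong (λ i → ·ᵥ-distribʳ-+ (c i) (d i) (V i)))
                (sumPt-+ᵥ (λ i → c i ·ᵥ V i) (λ i → d i ·ᵥ V i)))

  InLattice-·ᵥ : ∀ a {u} → InLattice V u → InLattice V (a ·ᵥ u)
  InLattice-·ᵥ a (c , refl) = (λ i → a ℤ.* c i) ,
    sym (trans (sumPt-cong (λ i → ·ᵥ-assoc a (c i) (V i))) (sumPt-·ᵥ a (λ i → c i ·ᵥ V i)))

  InLattice--ᵥ : ∀ {u v} → InLattice V u → InLattice V v → InLattice V (u -ᵥ v)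
  InLattice--ᵥ {u} {v} u∈ v∈ =
    subst (InLattice V) (sym (-ᵥ-as-+ᵥ u v)) (InLattice-+ᵥ u∈ (InLattice-·ᵥ ℤ.-1ℤ v∈))

  InLattice-zero : InLattice V zeroPt
  InLattice-zero = subst (InLattice V) (·ᵥ-zeroˡ _) (InLattice-·ᵥ (+ 0) ((λ _ → + 0) , refl))

  InLattice-VS : ∀ S → InLattice V (VS V S)
  InLattice-VS S = (λ i → if Vec.lookup S i then + 1 else + 0) ,
    sym (sumPt-cong (λ i → indicator (Vec.lookup S i) (V i)))
    where
    indicator : ∀ b (v : Pt n) → (if b then + 1 else + 0) ·ᵥ v ≡ (if b then v else zeroPt)
    indicator true  v = ·ᵥ-identityˡ v
    indicator false v = ·ᵥ-zeroˡ v

  scaled-difference∉Lattice : ∀ p {P₀ P₁ Q T : Pt n} →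
    InLattice V ((p ·ᵥ P₀) -ᵥ P₁) → InLattice V (Q -ᵥ P₀) → ¬ InLattice V (T -ᵥ P₁) →
    ¬ InLattice V ((p ·ᵥ Q) -ᵥ T)
  scaled-difference∉Lattice p {P₀} {P₁} {Q} {T} pP₀-P₁∈ Q-P₀∈ T-P₁∉ pQ-T∈ =
    T-P₁∉ (subst (InLattice V) (sym (difference-through-scaling p Q T P₁ P₀))
            (InLattice--ᵥ (InLattice-+ᵥ (InLattice-·ᵥ p Q-P₀∈) pP₀-P₁∈) pQ-T∈))

sumℚ-zero : ∀ {xs} → All (_≡ 0ℚ) xs → sumℚ xs ≡ 0ℚ
sumℚ-zero = foldr-preservesᵇ (λ { refl refl → refl }) refl

coeffX-off-lattice : ∀ {n} p (V : Fin n → Pt n) Ss R → ¬ InLattice V R → IsZeroS (coeffX p V Ss R)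
coeffX-off-lattice p V [] R R∉ m α with VecP.≡-dec ℤP._≟_ R zeroPt
... | yes refl = ⊥-elim (R∉ (InLattice-zero V))
... | no _     = refl
coeffX-off-lattice p V (S ∷ Ss) R R∉ m α =
  sumℚ-zero (All-map⁺ (universal term (List.upTo (suc m))))
  where
  c : ℕ
  c = card S ℕ.∸ 1
  term : ∀ j → (if j ℕ.≤ᵇ expAt α c
                then AH p j ℚ.* coeffX p V Ss (R -ᵥ ((+ j) ·ᵥ VS V S)) (m ℕ.∸ j) (subAt α c j)
                else 0ℚ) ≡ 0ℚ
  term j with j ℕ.≤ᵇ expAt α c
  ... | false = refl
  ... | true  = trans (cong (AH p j ℚ.*_) (coeffX-off-lattice p V Ss _ R-jVS∉ _ _)) (ℚP.*-zeroʳ (AH p j))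
    where
    R-jVS∉ : ¬ InLattice V (R -ᵥ ((+ j) ·ᵥ VS V S))
    R-jVS∉ R-jVS∈ = R∉ (subst (InLattice V) (sym (-ᵥ-+ᵥ-cancel R _))
                          (InLattice-+ᵥ V R-jVS∈ (InLattice-·ᵥ V (+ j) (InLattice-VS V S))))

*S-vanishes : ∀ {n} {f g : Series n} → (∀ i j β γ → f i β ℚ.* g j γ ≡ 0ℚ) → IsZeroS (f *S g)
*S-vanishes fg≡0 m α = sumℚ-zero (concat⁺ (All-map⁺ (universal
  (λ i → All-map⁺ (universal (λ β → fg≡0 i _ β _) (below α))) (List.upTo (suc m)))))

prodS-zero : ∀ {n} {fs : List (Series n)} → Any IsZeroS fs → IsZeroS (prodS fs)
prodS-zero {fs = f ∷ fs} (here f≡0) = *S-vanishes {f = f} {prodS fs} λ i j β γ →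
  trans (cong (ℚ._* prodS fs j γ) (f≡0 i β)) (ℚP.*-zeroˡ (prodS fs j γ))
prodS-zero {fs = f ∷ fs} (there fs≡0) = *S-vanishes {f = f} {prodS fs} λ i j β γ →
  trans (cong (f i β ℚ.*_) (prodS-zero fs≡0 j γ)) (ℚP.*-zeroʳ (f i β))

lemma5p4 : (n : ℕ) → 1 ≤ n →
    (V : Fin n → Pt n) → LinIndep V →
    (p : ℕ) → Prime p →
    (s : Sign) (k : ℕ) → 1 ≤ k →
    (τ : Pt n → Pt n) → IsBijOn (InΔ s k V) τ →
    (P₀ : Pt n) → InΔ minus 1 V P₀ →
    (ηP₀ : Pt n) → IsEta p V P₀ ηP₀ →
    (Q₀ : Pt n) → InΔP s k V P₀ Q₀ → ¬ InΔP s k V ηP₀ (τ Q₀) →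
    (L : List (Pt n)) → Unique L → ((Q : Pt n) → (Q ∈ L → InΔP s k V P₀ Q) × (InΔP s k V P₀ Q → Q ∈ L)) →
    IsZeroS (prodS (map (λ Q → eres p V (((+ p) ·ᵥ Q) -ᵥ τ Q)) L))
lemma5p4 n _ V _ p _ s k _ τ (τ-maps-into , _) P₀ _ ηP₀ (_ , pP₀-ηP₀∈)
         Q₀ Q₀∈@(Q₀∈Δ , Q₀-P₀∈) τQ₀∉ L _ L-enumerates =
  prodS-zero (Any-map⁺ (lose Q₀∈L factor-Q₀-zero))
  where
  Q₀∈L : Q₀ ∈ L
  Q₀∈L = proj₂ (L-enumerates Q₀) Q₀∈

  τQ₀-ηP₀∉ : ¬ InLattice V (τ Q₀ -ᵥ ηP₀)
  τQ₀-ηP₀∉ τQ₀-ηP₀∈ = τQ₀∉ (τ-maps-into Q₀ Q₀∈Δ , τQ₀-ηP₀∈)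

  factor-Q₀-zero : IsZeroS (eres p V (((+ p) ·ᵥ Q₀) -ᵥ τ Q₀))
  factor-Q₀-zero = coeffX-off-lattice p V (nonemptySubsets n) _
    (scaled-difference∉Lattice V (+ p) pP₀-ηP₀∈ Q₀-P₀∈ τQ₀-ηP₀∉)
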